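{- Let $n>1$ and let $S$ be an ideal aperiodic orientable sequence of order $n$. Then $D^{ -1}(S)$ consists of exactly two sequences, which are complements of each other: one begins with $n$ zeros and its final $n$ bits alternate (form a tuple $a_n$ of $n$ alternating bits), and the other begins with $n$ ones and ends with $\bar{a}_n$, the complement of $a_n$.
   Context: For a finite binary sequence $S=(s_0,\dots,s_{\ell-1})$, $\mathbf{s}_n(i)=(s_i,\dots,s_{i+n-1})$ for $0\le i\le\ell-n$; the reverse of $(u_0,\dots,u_{n-1})$ is $(u_{n-1},\dots,u_0)$. $S$ is an aperiodic orientable sequence of order $n$ if the $2\ell-2n+2$ tuples $\mathbf{s}_n(i)$ and their reverses ($0\le i\le\ell-n$) are all distinct. It is ideal ($n>1$) if its first $n-1$ bits are all $0$ and its last $n-1$ bits are all $1$. The complement swaps $0$ and $1$. Lempel map: $D(t_0,\dots,t_\ell)=(t_0\oplus t_1,\dots,t_{\ell-1}\oplus t_\ell)$; $D^{ -1}(S)$ is the set of binary sequences $T$ of length $\ell+1$ with $D(T)=S$. A tuple of alternating bits is one of the form $(0,1,0,1,\dots)$ or $(1,0,1,0,\dots)$. -}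

module Defs where

open import Data.Bool using (Bool; true; false; not; _xor_)
open import Data.Nat using (ℕ; zero; suc; _+_; _∸_; _≤_)
open import Data.List using (List; []; _∷_; take; drop; length; reverse; map; replicate; upTo; _++_)
open import Data.List.Relation.Unary.Unique.Propositional using (Unique)
open import Data.Product using (_×_)
open import Relation.Binary.PropositionalEquality using (_≡_)

-- binary sequences: false = 0, true = 1

window : ℕ → ℕ → List Bool → List Bool
window n i S = take n (drop i S)

windows : ℕ → List Bool → List (List Bool)
windows n S = map (λ i → window n i S) (upTo (suc (length S ∸ n)))

AperiodicOrientable : ℕ → List Bool → Set
AperiodicOrientable n S =
  n ≤ length S ×
  Unique (windows n S ++ map reverse (windows n S))

Ideal : ℕ → List Bool → Set
Ideal n S =
  take (n ∸ 1) S ≡ replicate (n ∸ 1) false ×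
  drop (length S ∸ (n ∸ 1)) S ≡ replicate (n ∸ 1) true

complement : List Bool → List Bool
complement = map not

D : List Bool → List Bool
D [] = []
D (x ∷ []) = []
D (x ∷ y ∷ t) = (x xor y) ∷ D (y ∷ t)

InDInv : List Bool → List Bool → Set
InDInv S T = length T ≡ suc (length S) × D T ≡ S

data Alternating : List Bool → Set where
  alt-[]  : Alternating []
  alt-[x] : ∀ x → Alternating (x ∷ [])
  alt-∷   : ∀ x t → Alternating (not x ∷ t) → Alternating (x ∷ not x ∷ t)

lastBits : ℕ → List Bool → List Bool
lastBits n T = drop (length T ∸ n) T

-- D⁻¹(S) is parametrised by the first bit b: the preimage is the running xor
-- `integrate b S`, and flipping b complements the whole preimage. A run of n-1
-- zeros at the start of S keeps the running xor constant for n bits, and a run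
-- of n-1 ones at the end makes it alternate for n bits.
{-# OPTIONS --safe #-}
module Submission where

open import Defs
open import Data.Bool using (Bool; true; false; not; _xor_)
open import Data.Bool.Properties using (xor-assoc; xor-same; xor-identityʳ; not-distribˡ-xor)
open import Data.Nat using (ℕ; _<_; suc; zero; _∸_; _≤_; s≤s)
open import Data.Nat.Properties using (m∸n≤m)
open import Data.List using (List; take; replicate; []; _∷_; length; drop; map)
open import Data.List.Properties using (length-map; drop-map; ∷-injective)
open import Data.Product using (Σ; ∃; _×_; _,_)
open import Data.Sum using (_⊎_; inj₁; inj₂)
open import Relation.Binary.PropositionalEquality
  using (_≡_; _≢_; refl; cong; cong₂; sym; trans; subst; module ≡-Reasoning)
open ≡-Reasoning

xor-cancelˡ : ∀ b s → b xor (b xor s) ≡ s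
xor-cancelˡ b s = trans (sym (xor-assoc b b s)) (cong (_xor s) (xor-same b))

partialXors : Bool → List Bool → List Bool
partialXors b []      = []
partialXors b (s ∷ S) = (b xor s) ∷ partialXors (b xor s) S

integrate : Bool → List Bool → List Bool
integrate b S = b ∷ partialXors b S

length-integrate : ∀ b S → length (integrate b S) ≡ suc (length S)
length-integrate b []      = refl
length-integrate b (s ∷ S) = cong suc (length-integrate (b xor s) S)

D-integrate : ∀ b S → D (integrate b S) ≡ S
D-integrate b []      = refl
D-integrate b (s ∷ S) = cong₂ _∷_ (xor-cancelˡ b s) (D-integrate (b xor s) S)

integrate-D : ∀ t T → integrate t (D (t ∷ T)) ≡ t ∷ T
integrate-D t []      = refl
integrate-D t (u ∷ T) = cong (t ∷_) (begin
  integrate (t xor (t xor u)) (D (u ∷ T)) ≡⟨ cong (λ x → integrate x (D (u ∷ T))) (xor-cancelˡ t u) ⟩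
  integrate u (D (u ∷ T))                 ≡⟨ integrate-D u T ⟩
  u ∷ T                                   ∎)

integrate-InDInv : ∀ b S → InDInv S (integrate b S)
integrate-InDInv b S = length-integrate b S , D-integrate b S

InDInv⇒integrate : ∀ S T → InDInv S T → T ≡ integrate false S ⊎ T ≡ integrate true S
InDInv⇒integrate S []          (() , _)
InDInv⇒integrate S (false ∷ T) (_ , refl) = inj₁ (sym (integrate-D false T))
InDInv⇒integrate S (true ∷ T)  (_ , refl) = inj₂ (sym (integrate-D true T))

integrate-not : ∀ b S → integrate (not b) S ≡ complement (integrate b S)
integrate-not b []      = refl
integrate-not b (s ∷ S) = cong (not b ∷_) (begin
  integrate (not b xor s) S         ≡⟨ cong (λ x → integrate x S) (sym (not-distribˡ-xor b s)) ⟩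
  integrate (not (b xor s)) S       ≡⟨ integrate-not (b xor s) S ⟩
  complement (integrate (b xor s) S) ∎)

take-integrate-zeros : ∀ k b S → take k S ≡ replicate k false →
                       take (suc k) (integrate b S) ≡ replicate (suc k) b
take-integrate-zeros zero    b S       _ = refl
take-integrate-zeros (suc k) b []      ()
take-integrate-zeros (suc k) b (s ∷ S) zeros with ∷-injective zeros
... | refl , zeros′ = cong (b ∷_) (subst (λ c → take (suc k) (integrate c S) ≡ replicate (suc k) b)
                                         (sym (xor-identityʳ b))
                                         (take-integrate-zeros k b S zeros′))

drop-integrate : ∀ m b S → m ≤ length S → ∃ λ c → drop m (integrate b S) ≡ integrate c (drop m S)
drop-integrate zero    b S       _       = b , refl
drop-integrate (suc m) b (s ∷ S) (s≤s p) = drop-integrate m (b xor s) S p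

integrate-ones-alternating : ∀ k c → Alternating (integrate c (replicate k true))
integrate-ones-alternating zero    c     = alt-[x] c
integrate-ones-alternating (suc k) false = alt-∷ false _ (integrate-ones-alternating k true)
integrate-ones-alternating (suc k) true  = alt-∷ true  _ (integrate-ones-alternating k false)

lastBits-integrate : ∀ k b S → drop (length S ∸ k) S ≡ replicate k true →
                     Alternating (lastBits (suc k) (integrate b S))
lastBits-integrate k b S ones with drop-integrate (length S ∸ k) b S (m∸n≤m (length S) k)
... | c , suffix = subst Alternating (sym lastBits≡) (integrate-ones-alternating k c)
  where
  lastBits≡ : lastBits (suc k) (integrate b S) ≡ integrate c (replicate k true)
  lastBits≡ = begin
    drop (length (integrate b S) ∸ suc k) (integrate b S) ≡⟨ cong (λ l → drop (l ∸ suc k) (integrate b S)) (length-integrate b S) ⟩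
    drop (length S ∸ k) (integrate b S)                   ≡⟨ suffix ⟩
    integrate c (drop (length S ∸ k) S)                   ≡⟨ cong (integrate c) ones ⟩
    integrate c (replicate k true)                        ∎

lastBits-complement : ∀ n T → lastBits n (complement T) ≡ complement (lastBits n T)
lastBits-complement n T = begin
  drop (length (map not T) ∸ n) (map not T) ≡⟨ cong (λ l → drop (l ∸ n) (map not T)) (length-map not T) ⟩
  drop (length T ∸ n) (map not T)           ≡⟨ drop-map (length T ∸ n) T ⟩
  map not (drop (length T ∸ n) T)           ∎

lemma3 : (n : ℕ) → 1 < n → (S : List Bool) →
    AperiodicOrientable n S → Ideal n S →
    Σ (List Bool) λ T₀ → Σ (List Bool) λ T₁ →
    InDInv S T₀ × InDInv S T₁ × T₀ ≢ T₁ ×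
    ((T : List Bool) → InDInv S T → T ≡ T₀ ⊎ T ≡ T₁) ×
    T₁ ≡ complement T₀ ×
    take n T₀ ≡ replicate n false × Alternating (lastBits n T₀) ×
    take n T₁ ≡ replicate n true × lastBits n T₁ ≡ complement (lastBits n T₀)
lemma3 (suc k) _ S _ (zeros , ones) =
  integrate false S , integrate true S ,
  integrate-InDInv false S ,
  integrate-InDInv true S ,
  (λ ()) ,
  InDInv⇒integrate S ,
  integrate-not false S ,
  take-integrate-zeros k false S zeros ,
  lastBits-integrate k false S ones ,
  take-integrate-zeros k true S zeros ,
  trans (cong (lastBits (suc k)) (integrate-not false S))
        (lastBits-complement (suc k) (integrate false S))
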